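{- Every metric space $A\in\mathcal{A}^3_{\infty,0,7,10}$ on $n\ge 3$ points consists of two $2$-cliques, one on $k$ points and one on $n-k$ points for some $0\le k\le n-k$ (i.e. its point set is the disjoint union of two such $2$-cliques), with the distances between points of different cliques being $1$ or $3$ in an arbitrary configuration; conversely, every such configuration of distances $1$ and $3$ between two $2$-cliques yields a space in $\mathcal{A}^3_{\infty,0,7,10}$.
   Context: $\mathcal{A}^3_{\infty,0,7,10}$ is the class of finite metric spaces, all of whose distances between distinct points lie in $\{1,2,3\}$, in which for every three distinct points the multiset of their pairwise distances is one of $\{1,1,2\}$, $\{1,2,3\}$, $\{2,2,2\}$, $\{2,3,3\}$. A $2$-clique is a set of points any two distinct members of which are at distance $2$ (it may be empty or a single point). -}

module Defs where

open import Data.Nat using (ℕ; _+_; _≤_; _∸_)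
open import Data.Fin using (Fin)
open import Data.Fin.Subset using (Subset; _∈_; _∉_; ∣_∣)
open import Data.List using (List; []; _∷_)
open import Data.List.Relation.Binary.Permutation.Propositional using (_↭_)
open import Data.Product using (_×_; ∃)
open import Data.Sum using (_⊎_)
open import Relation.Binary.PropositionalEquality using (_≡_)
open import Relation.Nullary using (¬_)

Dist : ℕ → Set
Dist n = Fin n → Fin n → ℕ

IsMetric : ∀ {n} → Dist n → Set
IsMetric {n} d =
  (∀ x y → d x y ≡ 0 → x ≡ y) ×
  (∀ x → d x x ≡ 0) ×
  (∀ x y → d x y ≡ d y x) ×
  (∀ x y z → d x z ≤ d x y + d y z)

DistIn123 : ∀ {n} → Dist n → Set
DistIn123 {n} d = ∀ x y → ¬ x ≡ y → (d x y ≡ 1 ⊎ d x y ≡ 2) ⊎ d x y ≡ 3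

AllowedTriangle : ℕ → ℕ → ℕ → Set
AllowedTriangle a b c =
  ((a ∷ b ∷ c ∷ []) ↭ (1 ∷ 1 ∷ 2 ∷ []) ⊎ (a ∷ b ∷ c ∷ []) ↭ (1 ∷ 2 ∷ 3 ∷ [])) ⊎
  ((a ∷ b ∷ c ∷ []) ↭ (2 ∷ 2 ∷ 2 ∷ []) ⊎ (a ∷ b ∷ c ∷ []) ↭ (2 ∷ 3 ∷ 3 ∷ []))

InA : ∀ {n} → Dist n → Set
InA {n} d =
  IsMetric d × DistIn123 d ×
  (∀ x y z → ¬ x ≡ y → ¬ y ≡ z → ¬ x ≡ z → AllowedTriangle (d x y) (d y z) (d x z))

SamePart : ∀ {n} → Subset n → Fin n → Fin n → Set
SamePart P x y = (x ∈ P × y ∈ P) ⊎ (x ∉ P × y ∉ P)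

TwoCliquesConfig : ∀ {n} → Dist n → Set
TwoCliquesConfig {n} d =
  (∀ x → d x x ≡ 0) ×
  (∀ x y → d x y ≡ d y x) ×
  ∃ λ (P : Subset n) →
    ∣ P ∣ ≤ n ∸ ∣ P ∣ ×
    (∀ x y → ¬ x ≡ y → SamePart P x y → d x y ≡ 2) ×
    (∀ x y → ¬ SamePart P x y → d x y ≡ 1 ⊎ d x y ≡ 3)

-- All four allowed triangle types {1,1,2}, {1,2,3}, {2,2,2}, {2,3,3} have even perimeter,
-- and conversely a triangle with sides in {1,2,3} and even perimeter is one of them and
-- satisfies the triangle inequality.  So for a symmetric d with zero diagonal and distances
-- in {1,2,3}, membership in the class says exactly that
-- parity (d x z) = parity (d x y) + parity (d y z) in ℤ/2.  Fixing a base point o, this means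
-- parity (d x y) = χ x + χ y with χ x = parity (d o x): the points split into the two colour
-- classes of χ, at even (hence 2) distance inside a class and at odd (hence 1 or 3) distance
-- across.  Replacing a class by its complement makes it the smaller one.
module Submission where

open import Defs
open import Data.Bool using (true; false; if_then_else_; not)
open import Data.Empty using (⊥-elim)
open import Data.Fin using (Fin; zero; _≟_)
open import Data.Fin.Subset using (Subset; _∈_; _∉_; ∣_∣; ∁)
open import Data.Fin.Subset.Properties using (_∈?_; ∣p∣≤n; ∣∁p∣≡n∸∣p∣)
open import Data.List using ([]; _∷_)
open import Data.Nat using (ℕ; suc; _+_; _∸_; _≤_; _≥_; _≤?_; z≤n; s≤s; parity)
open import Data.Nat.ListAction using (sum)
open import Data.Nat.ListAction.Properties using (sum-↭)
open import Data.Nat.Properties using (≤-refl; ≰⇒>; <⇒≤; m∸[m∸n]≡n)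
import Data.Nat.Properties as ℕ
open import Data.Parity using (Parity; 0ℙ; 1ℙ; _⁻¹)
import Data.Parity as ℙ
open import Data.Parity.Properties using (+-homo-+; p+p≡0ℙ; +-assoc; +-identityʳ)
import Data.Parity.Properties as ℙ
open import Data.Product using (_×_; _,_)
open import Data.Sum using (_⊎_; inj₁; inj₂)
open import Data.Vec using (lookup; tabulate)
open import Data.Vec.Properties using (lookup-map; lookup∘tabulate; []=⇒lookup; lookup⇒[]=)
import Data.List.Relation.Binary.Permutation.Propositional as ↭
open import Relation.Binary.PropositionalEquality
  using (_≡_; refl; sym; trans; cong; cong₂; subst; module ≡-Reasoning)
open import Relation.Nullary using (¬_; Dec; yes; no; does)

private
  variable
    n a b c v : ℕ
    p q : Parity

sum≡0ℙ⇒≡ : p ℙ.+ q ≡ 0ℙ → q ≡ p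
sum≡0ℙ⇒≡ {0ℙ} {0ℙ} _ = refl
sum≡0ℙ⇒≡ {1ℙ} {1ℙ} _ = refl

⁻¹+⁻¹≡+ : ∀ p q → p ⁻¹ ℙ.+ q ⁻¹ ≡ p ℙ.+ q
⁻¹+⁻¹≡+ 0ℙ 0ℙ = refl
⁻¹+⁻¹≡+ 0ℙ 1ℙ = refl
⁻¹+⁻¹≡+ 1ℙ 0ℙ = refl
⁻¹+⁻¹≡+ 1ℙ 1ℙ = refl

+-telescope : ∀ p q r → p ℙ.+ r ≡ (p ℙ.+ q) ℙ.+ (q ℙ.+ r)
+-telescope 0ℙ 0ℙ 0ℙ = refl
+-telescope 0ℙ 0ℙ 1ℙ = refl
+-telescope 0ℙ 1ℙ 0ℙ = refl
+-telescope 0ℙ 1ℙ 1ℙ = refl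
+-telescope 1ℙ 0ℙ 0ℙ = refl
+-telescope 1ℙ 0ℙ 1ℙ = refl
+-telescope 1ℙ 1ℙ 0ℙ = refl
+-telescope 1ℙ 1ℙ 1ℙ = refl

Dist123 : ℕ → Set
Dist123 v = (v ≡ 1 ⊎ v ≡ 2) ⊎ v ≡ 3

-- Indexing by the parity lets Agda rule out the odd-perimeter cases, so the two tables
-- below list only the 13 triangles of even perimeter.
data Side : ℕ → Parity → Set where
  one   : Side 1 1ℙ
  two   : Side 2 0ℙ
  three : Side 3 1ℙ

side : Dist123 v → Side v (parity v)
side (inj₁ (inj₁ refl)) = one
side (inj₁ (inj₂ refl)) = two
side (inj₂ refl)        = three

dist123⇒≢0 : Dist123 v → ¬ v ≡ 0
dist123⇒≢0 (inj₁ (inj₁ refl)) ()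
dist123⇒≢0 (inj₁ (inj₂ refl)) ()
dist123⇒≢0 (inj₂ refl)        ()

even-side⇒≡2 : Side v 0ℙ → v ≡ 2
even-side⇒≡2 two = refl

odd-side⇒≡1⊎≡3 : Side v 1ℙ → v ≡ 1 ⊎ v ≡ 3
odd-side⇒≡1⊎≡3 one   = inj₁ refl
odd-side⇒≡1⊎≡3 three = inj₂ refl

≡1⊎≡3⇒parity≡1ℙ : v ≡ 1 ⊎ v ≡ 3 → parity v ≡ 1ℙ
≡1⊎≡3⇒parity≡1ℙ (inj₁ refl) = refl
≡1⊎≡3⇒parity≡1ℙ (inj₂ refl) = refl

allowed⇒even-perimeter : AllowedTriangle a b c → parity (sum (a ∷ b ∷ c ∷ [])) ≡ 0ℙ
allowed⇒even-perimeter (inj₁ (inj₁ π)) = cong parity (sum-↭ π)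
allowed⇒even-perimeter (inj₁ (inj₂ π)) = cong parity (sum-↭ π)
allowed⇒even-perimeter (inj₂ (inj₁ π)) = cong parity (sum-↭ π)
allowed⇒even-perimeter (inj₂ (inj₂ π)) = cong parity (sum-↭ π)

allowed⇒parity-additive : AllowedTriangle a b c → parity c ≡ parity a ℙ.+ parity b
allowed⇒parity-additive {a} {b} {c} t = sum≡0ℙ⇒≡ (begin
  parity a ℙ.+ parity b ℙ.+ parity c     ≡⟨ +-assoc (parity a) (parity b) (parity c) ⟩
  parity a ℙ.+ (parity b ℙ.+ parity c)   ≡⟨ cong (parity a ℙ.+_) (+-homo-+ b c) ⟨
  parity a ℙ.+ parity (b + c)            ≡⟨ +-homo-+ a (b + c) ⟨
  parity (a + (b + c))                   ≡⟨ cong (λ m → parity (a + (b + m))) (ℕ.+-identityʳ c) ⟨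
  parity (sum (a ∷ b ∷ c ∷ []))          ≡⟨ allowed⇒even-perimeter t ⟩
  0ℙ                                     ∎)
  where open ≡-Reasoning

swap₁₂ : (a ∷ b ∷ c ∷ []) ↭.↭ (b ∷ a ∷ c ∷ [])
swap₁₂ {a} {b} = ↭.swap a b ↭.refl

swap₂₃ : (a ∷ b ∷ c ∷ []) ↭.↭ (a ∷ c ∷ b ∷ [])
swap₂₃ {a} {b} {c} = ↭.prep a (↭.swap b c ↭.refl)

even-perimeter⇒allowed : Side a p → Side b q → Side c (p ℙ.+ q) → AllowedTriangle a b c
even-perimeter⇒allowed two   two   two   = inj₂ (inj₁ ↭.refl)
even-perimeter⇒allowed one   one   two   = inj₁ (inj₁ ↭.refl)
even-perimeter⇒allowed one   three two   = inj₁ (inj₂ swap₂₃)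
even-perimeter⇒allowed three one   two   = inj₁ (inj₂ (↭.trans swap₁₂ swap₂₃))
even-perimeter⇒allowed three three two   = inj₂ (inj₂ (↭.trans swap₂₃ swap₁₂))
even-perimeter⇒allowed one   two   one   = inj₁ (inj₁ swap₂₃)
even-perimeter⇒allowed one   two   three = inj₁ (inj₂ ↭.refl)
even-perimeter⇒allowed three two   one   = inj₁ (inj₂ (↭.trans swap₁₂ (↭.trans swap₂₃ swap₁₂)))
even-perimeter⇒allowed three two   three = inj₂ (inj₂ swap₁₂)
even-perimeter⇒allowed two   one   one   = inj₁ (inj₁ (↭.trans swap₁₂ swap₂₃))
even-perimeter⇒allowed two   one   three = inj₁ (inj₂ swap₁₂)
even-perimeter⇒allowed two   three one   = inj₁ (inj₂ (↭.trans swap₂₃ swap₁₂))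
even-perimeter⇒allowed two   three three = inj₂ (inj₂ ↭.refl)

even-perimeter⇒triangle : Side a p → Side b q → Side c (p ℙ.+ q) → c ≤ a + b
even-perimeter⇒triangle two   two   two   = s≤s (s≤s z≤n)
even-perimeter⇒triangle one   one   two   = s≤s (s≤s z≤n)
even-perimeter⇒triangle one   three two   = s≤s (s≤s z≤n)
even-perimeter⇒triangle three one   two   = s≤s (s≤s z≤n)
even-perimeter⇒triangle three three two   = s≤s (s≤s z≤n)
even-perimeter⇒triangle one   two   one   = s≤s z≤n
even-perimeter⇒triangle one   two   three = s≤s (s≤s (s≤s z≤n))
even-perimeter⇒triangle three two   one   = s≤s z≤n
even-perimeter⇒triangle three two   three = s≤s (s≤s (s≤s z≤n))
even-perimeter⇒triangle two   one   one   = s≤s z≤n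
even-perimeter⇒triangle two   one   three = s≤s (s≤s (s≤s z≤n))
even-perimeter⇒triangle two   three one   = s≤s z≤n
even-perimeter⇒triangle two   three three = s≤s (s≤s (s≤s z≤n))

ParityAdditive : Dist n → Set
ParityAdditive d = ∀ x y z → parity (d x z) ≡ parity (d x y) ℙ.+ parity (d y z)

InA⇒parityAdditive : {d : Dist n} → InA d → ParityAdditive d
InA⇒parityAdditive {d = d} ((_ , diag , symm , _) , _ , allowed) x y z with x ≟ y | y ≟ z | x ≟ z
... | yes refl | _        | _        rewrite diag x = refl
... | no _     | yes refl | _        rewrite diag y = sym (+-identityʳ _)
... | no _     | no _     | yes refl rewrite diag x | symm y x = sym (p+p≡0ℙ (parity (d x y)))
... | no x≢y   | no y≢z   | no x≢z   = allowed⇒parity-additive (allowed x y z x≢y y≢z x≢z)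

parityAdditive⇒InA : {d : Dist n} → (∀ x → d x x ≡ 0) → (∀ x y → d x y ≡ d y x) →
                     DistIn123 d → ParityAdditive d → InA d
parityAdditive⇒InA {d = d} diag symm d123 additive =
  (zero⇒≡ , diag , symm , triangle) , d123 , allowed
  where
  side-xz : ∀ {x y z} → ¬ x ≡ z → Side (d x z) (parity (d x y) ℙ.+ parity (d y z))
  side-xz {x} {y} {z} x≢z = subst (Side (d x z)) (additive x y z) (side (d123 x z x≢z))

  zero⇒≡ : ∀ x y → d x y ≡ 0 → x ≡ y
  zero⇒≡ x y dxy≡0 with x ≟ y
  ... | yes x≡y = x≡y
  ... | no x≢y  = ⊥-elim (dist123⇒≢0 (d123 x y x≢y) dxy≡0)

  triangle : ∀ x y z → d x z ≤ d x y + d y z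
  triangle x y z with x ≟ z | x ≟ y | y ≟ z
  ... | yes refl | _        | _        rewrite diag x = z≤n
  ... | no _     | yes refl | _        rewrite diag x = ≤-refl
  ... | no _     | no _     | yes refl rewrite diag y | ℕ.+-identityʳ (d x y) = ≤-refl
  ... | no x≢z   | no x≢y   | no y≢z   =
    even-perimeter⇒triangle (side (d123 x y x≢y)) (side (d123 y z y≢z)) (side-xz x≢z)

  allowed : ∀ x y z → ¬ x ≡ y → ¬ y ≡ z → ¬ x ≡ z → AllowedTriangle (d x y) (d y z) (d x z)
  allowed x y z x≢y y≢z x≢z =
    even-perimeter⇒allowed (side (d123 x y x≢y)) (side (d123 y z y≢z)) (side-xz x≢z)

colour : Subset n → Fin n → Parity
colour P x = if lookup P x then 0ℙ else 1ℙ

IsParityCut : Dist n → Subset n → Set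
IsParityCut d P = ∀ x y → parity (d x y) ≡ colour P x ℙ.+ colour P y

fibre₀ : (Fin n → Parity) → Subset n
fibre₀ χ = tabulate (λ x → does (χ x ℙ.≟ 0ℙ))

colour-fibre₀ : (χ : Fin n → Parity) (x : Fin n) → colour (fibre₀ χ) x ≡ χ x
colour-fibre₀ χ x rewrite lookup∘tabulate (λ y → does (χ y ℙ.≟ 0ℙ)) x with χ x
... | 0ℙ = refl
... | 1ℙ = refl

colour-∁ : (P : Subset n) (x : Fin n) → colour (∁ P) x ≡ colour P x ⁻¹
colour-∁ P x rewrite lookup-map x not P with lookup P x
... | true  = refl
... | false = refl

∈⇒colour≡0ℙ : {P : Subset n} {x : Fin n} → x ∈ P → colour P x ≡ 0ℙ
∈⇒colour≡0ℙ x∈P rewrite []=⇒lookup x∈P = refl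

∉⇒colour≡1ℙ : {P : Subset n} {x : Fin n} → x ∉ P → colour P x ≡ 1ℙ
∉⇒colour≡1ℙ {P = P} {x} x∉P with lookup P x in eq
... | true  = ⊥-elim (x∉P (lookup⇒[]= x P eq))
... | false = refl

samePart⇒colour-sum≡0ℙ : {P : Subset n} {x y : Fin n} →
                         SamePart P x y → colour P x ℙ.+ colour P y ≡ 0ℙ
samePart⇒colour-sum≡0ℙ (inj₁ (x∈P , y∈P)) rewrite ∈⇒colour≡0ℙ x∈P | ∈⇒colour≡0ℙ y∈P = refl
samePart⇒colour-sum≡0ℙ (inj₂ (x∉P , y∉P)) rewrite ∉⇒colour≡1ℙ x∉P | ∉⇒colour≡1ℙ y∉P = refl

¬samePart⇒colour-sum≡1ℙ : {P : Subset n} {x y : Fin n} →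
                          ¬ SamePart P x y → colour P x ℙ.+ colour P y ≡ 1ℙ
¬samePart⇒colour-sum≡1ℙ {P = P} {x} {y} ¬same with x ∈? P | y ∈? P
... | yes x∈P | yes y∈P = ⊥-elim (¬same (inj₁ (x∈P , y∈P)))
... | no x∉P  | no y∉P  = ⊥-elim (¬same (inj₂ (x∉P , y∉P)))
... | yes x∈P | no y∉P  rewrite ∈⇒colour≡0ℙ x∈P | ∉⇒colour≡1ℙ y∉P = refl
... | no x∉P  | yes y∈P rewrite ∉⇒colour≡1ℙ x∉P | ∈⇒colour≡0ℙ y∈P = refl

samePart? : (P : Subset n) (x y : Fin n) → Dec (SamePart P x y)
samePart? P x y with x ∈? P | y ∈? P
... | yes x∈P | yes y∈P = yes (inj₁ (x∈P , y∈P))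
... | no x∉P  | no y∉P  = yes (inj₂ (x∉P , y∉P))
... | yes x∈P | no y∉P  = no λ { (inj₁ (_ , y∈P)) → y∉P y∈P ; (inj₂ (x∉P , _)) → x∉P x∈P }
... | no x∉P  | yes y∈P = no λ { (inj₁ (x∈P , _)) → x∉P x∈P ; (inj₂ (_ , y∉P)) → y∉P y∈P }

parityAdditive⇒cut : {d : Dist n} → (∀ x y → d x y ≡ d y x) → ParityAdditive d →
                     (o : Fin n) → IsParityCut d (fibre₀ (λ x → parity (d o x)))
parityAdditive⇒cut {d = d} symm additive o x y = begin
  parity (d x y)                         ≡⟨ additive x o y ⟩
  parity (d x o) ℙ.+ parity (d o y)      ≡⟨ cong (ℙ._+ parity (d o y)) (cong parity (symm x o)) ⟩
  parity (d o x) ℙ.+ parity (d o y)      ≡⟨ cong₂ ℙ._+_ (colour-fibre₀ χ x) (colour-fibre₀ χ y) ⟨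
  colour P x ℙ.+ colour P y              ∎
  where
  open ≡-Reasoning
  χ = λ z → parity (d o z)
  P = fibre₀ χ

cut⇒parityAdditive : {d : Dist n} {P : Subset n} → IsParityCut d P → ParityAdditive d
cut⇒parityAdditive {d = d} {P} cut x y z = begin
  parity (d x z)
    ≡⟨ cut x z ⟩
  colour P x ℙ.+ colour P z
    ≡⟨ +-telescope (colour P x) (colour P y) (colour P z) ⟩
  (colour P x ℙ.+ colour P y) ℙ.+ (colour P y ℙ.+ colour P z)
    ≡⟨ cong₂ ℙ._+_ (cut x y) (cut y z) ⟨
  parity (d x y) ℙ.+ parity (d y z)
    ∎
  where open ≡-Reasoning

cut-∁ : {d : Dist n} {P : Subset n} → IsParityCut d P → IsParityCut d (∁ P)
cut-∁ {d = d} {P} cut x y = begin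
  parity (d x y)                         ≡⟨ cut x y ⟩
  colour P x ℙ.+ colour P y              ≡⟨ ⁻¹+⁻¹≡+ (colour P x) (colour P y) ⟨
  colour P x ⁻¹ ℙ.+ colour P y ⁻¹        ≡⟨ cong₂ ℙ._+_ (colour-∁ P x) (colour-∁ P y) ⟨
  colour (∁ P) x ℙ.+ colour (∁ P) y      ∎
  where open ≡-Reasoning

TwoCliquesOn : Dist n → Subset n → Set
TwoCliquesOn d P =
  (∀ x y → ¬ x ≡ y → SamePart P x y → d x y ≡ 2) ×
  (∀ x y → ¬ SamePart P x y → d x y ≡ 1 ⊎ d x y ≡ 3)

cut⇒twoCliquesOn : {d : Dist n} {P : Subset n} → DistIn123 d → IsParityCut d P → TwoCliquesOn d P
cut⇒twoCliquesOn {d = d} {P} d123 cut = same , cross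
  where
  same : ∀ x y → ¬ x ≡ y → SamePart P x y → d x y ≡ 2
  same x y x≢y s = even-side⇒≡2
    (subst (Side (d x y)) (trans (cut x y) (samePart⇒colour-sum≡0ℙ s)) (side (d123 x y x≢y)))

  cross : ∀ x y → ¬ SamePart P x y → d x y ≡ 1 ⊎ d x y ≡ 3
  cross x y ¬s with x ≟ y
  ... | yes refl =
    ⊥-elim (ℙ.p≢p⁻¹ 0ℙ (trans (sym (p+p≡0ℙ (colour P x))) (¬samePart⇒colour-sum≡1ℙ ¬s)))
  ... | no x≢y   = odd-side⇒≡1⊎≡3
    (subst (Side (d x y)) (trans (cut x y) (¬samePart⇒colour-sum≡1ℙ ¬s)) (side (d123 x y x≢y)))

twoCliquesOn⇒distIn123 : {d : Dist n} {P : Subset n} → TwoCliquesOn d P → DistIn123 d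
twoCliquesOn⇒distIn123 {P = P} (same , cross) x y x≢y with samePart? P x y
... | yes s = inj₁ (inj₂ (same x y x≢y s))
... | no ¬s with cross x y ¬s
...   | inj₁ dxy≡1 = inj₁ (inj₁ dxy≡1)
...   | inj₂ dxy≡3 = inj₂ dxy≡3

twoCliquesOn⇒cut : {d : Dist n} {P : Subset n} →
                   (∀ x → d x x ≡ 0) → TwoCliquesOn d P → IsParityCut d P
twoCliquesOn⇒cut {P = P} diag (same , cross) x y with x ≟ y
... | yes refl rewrite diag x = sym (p+p≡0ℙ (colour P x))
... | no x≢y with samePart? P x y
...   | yes s  rewrite same x y x≢y s = sym (samePart⇒colour-sum≡0ℙ s)
...   | no ¬s  = trans (≡1⊎≡3⇒parity≡1ℙ (cross x y ¬s)) (sym (¬samePart⇒colour-sum≡1ℙ ¬s))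

smaller-half : (P : Subset n) → ∣ P ∣ ≤ n ∸ ∣ P ∣ ⊎ ∣ ∁ P ∣ ≤ n ∸ ∣ ∁ P ∣
smaller-half {n} P with ∣ P ∣ ≤? n ∸ ∣ P ∣
... | yes small = inj₁ small
... | no large rewrite ∣∁p∣≡n∸∣p∣ P | m∸[m∸n]≡n (∣p∣≤n P) = inj₂ (<⇒≤ (≰⇒> large))

cut⇒twoCliquesConfig : {d : Dist n} {P : Subset n} → (∀ x → d x x ≡ 0) → (∀ x y → d x y ≡ d y x) →
                       DistIn123 d → IsParityCut d P → TwoCliquesConfig d
cut⇒twoCliquesConfig {d = d} {P} diag symm d123 cut with smaller-half P
... | inj₁ small = diag , symm , P , small , cut⇒twoCliquesOn d123 cut
... | inj₂ small = diag , symm , ∁ P , small , cut⇒twoCliquesOn d123 (cut-∁ {d = d} {P} cut)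

lemma2p12 : (n : ℕ) → n ≥ 3 → (d : Dist n) →
    (InA d → TwoCliquesConfig d) × (TwoCliquesConfig d → InA d)
lemma2p12 (suc n) _ d = inA⇒config , config⇒inA
  where
  inA⇒config : InA d → TwoCliquesConfig d
  inA⇒config A@((_ , diag , symm , _) , d123 , _) =
    cut⇒twoCliquesConfig {P = fibre₀ (λ x → parity (d zero x))} diag symm d123
      (parityAdditive⇒cut symm (InA⇒parityAdditive A) zero)

  config⇒inA : TwoCliquesConfig d → InA d
  config⇒inA (diag , symm , P , _ , cliques) =
    parityAdditive⇒InA diag symm (twoCliquesOn⇒distIn123 cliques)
      (cut⇒parityAdditive {d = d} {P} (twoCliquesOn⇒cut diag cliques))
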